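{- Let $Z=\sum_{i=1}^{k}\sum_{e=1}^{l_i}Z^{(i)}_e$ be a bags-of-dice martingale of $d\times d$ matrices, let $\epsilon>0$, and let $\widetilde{Z}$ be the associated $\epsilon$-truncated martingale. Then the events $\mathcal{A}_{k+1}$ and $[\widetilde{Z}\preceq\epsilon I]$ coincide.
   Context: A bags-of-dice martingale is a sum $Z=\sum_{i=1}^{k}\sum_{e=1}^{l_i}Z^{(i)}_e$ of random $d\times d$ matrices together with random variables $(r_1,R^{(1)},\dots,r_k,R^{(k)})$ such that for all $i$: conditional on $(r_1,R^{(1)},\dots,r_{i-1},R^{(i-1)})$ and $r_i$, $l_i$ is a fixed non-negative integer and $R^{(i)}=(R^{(i)}_1,\dots,R^{(i)}_{l_i})$ consists of $l_i$ independent random variables; conditionally, each $Z^{(i)}_e$ is symmetric and a deterministic function of $R^{(i)}_e$ with conditional mean zero. For $h\in\{1,\dots,k+1\}$, $\mathcal{A}_h$ is the event that for all $1\le j<h$, $\sum_{i=1}^{j}\sum_{e=1}^{l_i}Z^{(i)}_e\preceq\epsilon I$. The $\epsilon$-truncated martingale is $\widetilde{Z}=\sum_{i=1}^{k}\mathbb{1}_{\mathcal{A}_i}\sum_{e=1}^{l_i}Z^{(i)}_e$. -}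

module Defs where

open import Level using (Level; _⊔_) renaming (suc to lsuc)
open import Data.Nat using (ℕ; zero; suc; _≤_; _<_)
open import Data.Fin using (Fin; zero; suc; toℕ; _≟_)
open import Data.Bool using (Bool; true; false; if_then_else_)
open import Data.Product using (_×_)
open import Relation.Nullary using (¬_; does)
open import Relation.Binary using (Rel; IsTotalOrder)
open import Algebra.Bundles using (CommutativeRing)

-- Scalars: an ordered commutative ring (the real numbers are the intended
-- model; every axiom below holds in ℝ).
record OrderedCommutativeRing (c ℓ₁ ℓ₂ : Level) : Set (lsuc (c ⊔ ℓ₁ ⊔ ℓ₂)) where
  field
    commutativeRing : CommutativeRing c ℓ₁
  open CommutativeRing commutativeRing public
  infix 4 _≤ₛ_ _<ₛ_
  field
    _≤ₛ_         : Rel Carrier ℓ₂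
    isTotalOrder : IsTotalOrder _≈_ _≤ₛ_
    +-monoʳ-≤ₛ   : ∀ x {y z} → y ≤ₛ z → (x + y) ≤ₛ (x + z)
    *-nonneg     : ∀ {x y} → 0# ≤ₛ x → 0# ≤ₛ y → 0# ≤ₛ (x * y)
  _<ₛ_ : Carrier → Carrier → Set (ℓ₁ ⊔ ℓ₂)
  x <ₛ y = (x ≤ₛ y) × ¬ (x ≈ y)

module Matrices {c ℓ₁ ℓ₂ : Level} (R : OrderedCommutativeRing c ℓ₁ ℓ₂) where
  open OrderedCommutativeRing R using (Carrier; _≈_; _+_; _-_; _*_; 0#; _≤ₛ_)

  ∑ : (n : ℕ) → (Fin n → Carrier) → Carrier
  ∑ zero    f = 0#
  ∑ (suc n) f = f zero + ∑ n (λ i → f (suc i))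

  Mat : ℕ → Set c
  Mat d = Fin d → Fin d → Carrier

  0M : ∀ {d} → Mat d
  0M i j = 0#

  _+M_ : ∀ {d} → Mat d → Mat d → Mat d
  (A +M B) i j = A i j + B i j

  _-M_ : ∀ {d} → Mat d → Mat d → Mat d
  (A -M B) i j = A i j - B i j

  scalarI : ∀ {d} → Carrier → Mat d
  scalarI ε i j = if does (i ≟ j) then ε else 0#

  ∑M : ∀ {d} (n : ℕ) → (Fin n → Mat d) → Mat d
  ∑M zero    f = 0M
  ∑M (suc n) f = f zero +M ∑M n (λ i → f (suc i))

  Symmetric : ∀ {d} → Mat d → Set ℓ₁
  Symmetric A = ∀ i j → A i j ≈ A j i

  quad : ∀ {d} → (Fin d → Carrier) → Mat d → Carrier
  quad {d} v A = ∑ d (λ i → ∑ d (λ j → v i * (A i j * v j)))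

  _⪯_ : ∀ {d} → Mat d → Mat d → Set (c ⊔ ℓ₂)
  _⪯_ {d} A B = ∀ (v : Fin d → Carrier) → 0# ≤ₛ quad v (B -M A)

  -- sum of the first j terms of a length-k sequence (j ≥ k gives the full sum)
  prefixSum : ∀ {d} (k : ℕ) → (Fin k → Mat d) → ℕ → Mat d
  prefixSum zero    f j       = 0M
  prefixSum (suc k) f zero    = 0M
  prefixSum (suc k) f (suc j) = f zero +M prefixSum k (λ i → f (suc i)) j

  module BagsOfDice {d k : ℕ} {Ω : Set}
      (l : Fin k → Ω → ℕ)
      (Z : (i : Fin k) → (ω : Ω) → Fin (l i ω) → Mat d)
      (ε : Carrier) where

    bag : Fin k → Ω → Mat d
    bag i ω = ∑M (l i ω) (Z i ω)

    S : ℕ → Ω → Mat d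
    S j ω = prefixSum k (λ i → bag i ω) j

    𝒜 : ℕ → Ω → Set (c ⊔ ℓ₂)
    𝒜 h ω = ∀ j → 1 ≤ j → j < h → S j ω ⪯ scalarI ε

    -- ε-truncated martingale, given indicator functions χ i of the events 𝒜_i
    -- (bag i : Fin k corresponds to index toℕ i + 1)
    Ztilde : (Fin k → Ω → Bool) → Ω → Mat d
    Ztilde χ ω = ∑M k (λ i → if χ i ω then bag i ω else 0M)

-- Membership in the events 𝒜_h only shrinks as h grows, so the indicators
-- 1_{𝒜_i} form a block of ones followed by zeros.  If τ is the length of that
-- block, then Z̃ is exactly the partial sum S_τ, and 𝒜_τ holds.  Hence
-- Z̃ ⪯ εI says precisely that 𝒜_{τ+1} holds, which forces τ = k (otherwise the
-- indicator at τ would be one); conversely 𝒜_{k+1} makes every indicator one,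
-- so Z̃ = S_k ⪯ εI.
module Submission where

open import Defs
open import Level using (Level; _⊔_)
open import Data.Nat using (ℕ; zero; suc; _≤_; _<_; z≤n; s≤s; s<s⁻¹)
open import Data.Nat.Properties using (≤-trans; ≤-refl; ≤-reflexive; n≮0; <-irrefl; m≤n⇒m<n∨m≡n)
open import Data.Fin using (Fin; toℕ; zero; suc; fromℕ<) renaming (_≟_ to _≟ᶠ_)
open import Data.Fin.Properties using (toℕ-fromℕ<)
open import Data.Bool using (Bool; true; false; if_then_else_)
open import Data.Product using (_×_; _,_; proj₁; proj₂)
open import Data.Sum using (inj₁; inj₂)
open import Data.Empty using (⊥-elim)
open import Relation.Nullary using (yes; no)
open import Relation.Binary using (IsTotalOrder; TotalOrder)
open import Relation.Binary.PropositionalEquality using (_≡_; subst)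
import Relation.Binary.PropositionalEquality as ≡
import Algebra.Properties.Ring as RingProperties
import Relation.Binary.Reasoning.PartialOrder as PartialOrderReasoning

leadingTrues : ∀ n → (Fin n → Bool) → ℕ
leadingTrues zero    b = 0
leadingTrues (suc n) b = if b zero then suc (leadingTrues n (λ i → b (suc i))) else 0

leadingTrues-≤ : ∀ n (b : Fin n → Bool) → leadingTrues n b ≤ n
leadingTrues-≤ zero    b = z≤n
leadingTrues-≤ (suc n) b with b zero
... | true  = s≤s (leadingTrues-≤ n (λ i → b (suc i)))
... | false = z≤n

leadingTrues-true : ∀ n (b : Fin n → Bool) (i : Fin n) → toℕ i < leadingTrues n b → b i ≡ true
leadingTrues-true (suc n) b i       i< with b zero in eq
leadingTrues-true (suc n) b zero    i<       | true = eq
leadingTrues-true (suc n) b (suc i) (s≤s i<) | true = leadingTrues-true n (λ i → b (suc i)) i i<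

DownwardClosed : ∀ n → (Fin n → Bool) → Set
DownwardClosed n b = ∀ {i j : Fin n} → toℕ i ≤ toℕ j → b j ≡ true → b i ≡ true

leadingTrues-complete : ∀ n (b : Fin n → Bool) → DownwardClosed n b →
                        ∀ i → b i ≡ true → toℕ i < leadingTrues n b
leadingTrues-complete (suc n) b closed i bi with b zero in eq
leadingTrues-complete (suc n) b closed zero    bi | true = s≤s z≤n
leadingTrues-complete (suc n) b closed (suc i) bi | true =
  s≤s (leadingTrues-complete n (λ i → b (suc i)) (λ i≤j → closed (s≤s i≤j)) i bi)
leadingTrues-complete (suc n) b closed i       bi | false
  with () ← ≡.trans (≡.sym (closed {zero} z≤n bi)) eq

module _ {c ℓ₁ ℓ₂ : Level} (R : OrderedCommutativeRing c ℓ₁ ℓ₂) where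
  open OrderedCommutativeRing R hiding (zero)
  open Matrices R
  open RingProperties ring using (-0#≈0#; -‿distribˡ-*; -‿distribʳ-*; -‿involutive)
  private module ≤ₛ = IsTotalOrder isTotalOrder

  totalOrder : TotalOrder c ℓ₁ ℓ₂
  totalOrder = record { Carrier = Carrier ; _≈_ = _≈_ ; _≤_ = _≤ₛ_ ; isTotalOrder = isTotalOrder }

  open PartialOrderReasoning (TotalOrder.poset totalOrder)

  +-nonneg : ∀ {x y} → 0# ≤ₛ x → 0# ≤ₛ y → 0# ≤ₛ x + y
  +-nonneg {x} {y} 0≤x 0≤y = begin
    0#      ≤⟨ 0≤x ⟩
    x       ≈⟨ +-identityʳ x ⟨
    x + 0#  ≤⟨ +-monoʳ-≤ₛ x 0≤y ⟩
    x + y   ∎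

  neg-nonneg : ∀ {x} → x ≤ₛ 0# → 0# ≤ₛ - x
  neg-nonneg {x} x≤0 = begin
    0#        ≈⟨ -‿inverseˡ x ⟨
    - x + x   ≤⟨ +-monoʳ-≤ₛ (- x) x≤0 ⟩
    - x + 0#  ≈⟨ +-identityʳ (- x) ⟩
    - x       ∎

  square-nonneg : ∀ x → 0# ≤ₛ x * x
  square-nonneg x with ≤ₛ.total 0# x
  ... | inj₁ 0≤x = *-nonneg 0≤x 0≤x
  ... | inj₂ x≤0 = begin
    0#              ≤⟨ *-nonneg (neg-nonneg x≤0) (neg-nonneg x≤0) ⟩
    (- x) * (- x)   ≈⟨ -‿distribˡ-* x (- x) ⟨
    - (x * - x)     ≈⟨ -‿cong (-‿distribʳ-* x x) ⟨
    - - (x * x)     ≈⟨ -‿involutive (x * x) ⟩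
    x * x           ∎

  ∑-nonneg : ∀ n (f : Fin n → Carrier) → (∀ i → 0# ≤ₛ f i) → 0# ≤ₛ ∑ n f
  ∑-nonneg zero    f f≥0 = ≤ₛ.refl
  ∑-nonneg (suc n) f f≥0 = +-nonneg (f≥0 zero) (∑-nonneg n (λ i → f (suc i)) (λ i → f≥0 (suc i)))

  ∑-cong : ∀ n {f g : Fin n → Carrier} → (∀ i → f i ≈ g i) → ∑ n f ≈ ∑ n g
  ∑-cong zero    f≈g = refl
  ∑-cong (suc n) f≈g = +-cong (f≈g zero) (∑-cong n (λ i → f≈g (suc i)))

  infix 4 _≈M_
  _≈M_ : ∀ {d} → Mat d → Mat d → Set ℓ₁
  A ≈M B = ∀ i j → A i j ≈ B i j

  ≈M-sym : ∀ {d} {A B : Mat d} → A ≈M B → B ≈M A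
  ≈M-sym A≈B i j = sym (A≈B i j)

  ⪯-respˡ-≈M : ∀ {d} {A B C : Mat d} → A ≈M B → A ⪯ C → B ⪯ C
  ⪯-respˡ-≈M {d} {A} {B} {C} A≈B A⪯C v = begin
    0#                ≤⟨ A⪯C v ⟩
    quad v (C -M A)   ≈⟨ ∑-cong d (λ i → ∑-cong d (λ j →
                           *-congˡ (*-congʳ (+-congˡ (-‿cong (A≈B i j)))))) ⟩
    quad v (C -M B)   ∎

  0M⪯scalarI : ∀ {d} {ε} → 0# ≤ₛ ε → 0M {d} ⪯ scalarI ε
  0M⪯scalarI {d} {ε} 0≤ε v = ∑-nonneg d _ (λ i → ∑-nonneg d _ (λ j → entry-nonneg i j))
    where
    entry-nonneg : ∀ i j → 0# ≤ₛ v i * ((scalarI ε -M 0M) i j * v j)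
    entry-nonneg i j with i ≟ᶠ j
    ... | yes ≡.refl = begin
      0#                        ≤⟨ *-nonneg 0≤ε (square-nonneg (v i)) ⟩
      ε * (v i * v i)           ≈⟨ *-assoc ε (v i) (v i) ⟨
      (ε * v i) * v i           ≈⟨ *-congʳ (*-comm ε (v i)) ⟩
      (v i * ε) * v i           ≈⟨ *-assoc (v i) ε (v i) ⟩
      v i * (ε * v i)           ≈⟨ *-congˡ (*-congʳ (trans (+-congˡ -0#≈0#) (+-identityʳ ε))) ⟨
      v i * ((ε - 0#) * v i)    ∎
    ... | no _ = begin
      0#                        ≈⟨ zeroʳ (v i) ⟨
      v i * 0#                  ≈⟨ *-congˡ (zeroˡ (v j)) ⟨
      v i * (0# * v j)          ≈⟨ *-congˡ (*-congʳ (-‿inverseʳ 0#)) ⟨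
      v i * ((0# - 0#) * v j)   ∎

  prefixSum-zero : ∀ {d} k (f : Fin k → Mat d) → prefixSum k f 0 ≈M 0M
  prefixSum-zero zero    f i j = refl
  prefixSum-zero (suc k) f i j = refl

  ∑M-masked≈prefixSum : ∀ {d} k (f : Fin k → Mat d) (b : Fin k → Bool) m →
                        (∀ i → toℕ i < m → b i ≡ true) → (∀ i → b i ≡ true → toℕ i < m) →
                        ∑M k (λ i → if b i then f i else 0M) ≈M prefixSum k f m
  ∑M-masked≈prefixSum zero f b m below above i j = refl
  ∑M-masked≈prefixSum (suc k) f b zero below above i j with b zero in eq
  ... | true  = ⊥-elim (n≮0 (above zero eq))
  ... | false = trans (+-identityˡ _)
    (trans (∑M-masked≈prefixSum k (λ i → f (suc i)) (λ i → b (suc i)) zero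
              (λ i ()) (λ i bi → ⊥-elim (n≮0 (above (suc i) bi))) i j)
           (prefixSum-zero k (λ i → f (suc i)) i j))
  ∑M-masked≈prefixSum (suc k) f b (suc m) below above i j rewrite below zero (s≤s z≤n) =
    +-congˡ (∑M-masked≈prefixSum k (λ i → f (suc i)) (λ i → b (suc i)) m
               (λ i i<m → below (suc i) (s≤s i<m))
               (λ i bi → s<s⁻¹ (above (suc i) bi)) i j)

  module BagsOfDiceProperties {d k : ℕ} {Ω : Set} (l : Fin k → Ω → ℕ)
      (Z : (i : Fin k) → (ω : Ω) → Fin (l i ω) → Mat d) (ε : Carrier) where
    open BagsOfDice l Z ε

    𝒜-zero : ∀ ω → 𝒜 0 ω
    𝒜-zero ω j 1≤j ()

    𝒜-antitone : ∀ {h h′} ω → h ≤ h′ → 𝒜 h′ ω → 𝒜 h ω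
    𝒜-antitone ω h≤h′ 𝒜h′ j 1≤j j<h = 𝒜h′ j 1≤j (≤-trans j<h h≤h′)

    𝒜-suc : ∀ {h} ω → 𝒜 h ω → S h ω ⪯ scalarI ε → 𝒜 (suc h) ω
    𝒜-suc ω 𝒜h Sh⪯εI j 1≤j (s≤s j≤h) with m≤n⇒m<n∨m≡n j≤h
    ... | inj₁ j<h   = 𝒜h j 1≤j j<h
    ... | inj₂ ≡.refl = Sh⪯εI

    𝒜-suc⇒S⪯scalarI : 0# ≤ₛ ε → ∀ h ω → 𝒜 (suc h) ω → S h ω ⪯ scalarI ε
    𝒜-suc⇒S⪯scalarI 0≤ε zero    ω _   = ⪯-respˡ-≈M (≈M-sym (prefixSum-zero k _)) (0M⪯scalarI 0≤ε)
    𝒜-suc⇒S⪯scalarI 0≤ε (suc h) ω 𝒜h = 𝒜h (suc h) (s≤s z≤n) ≤-refl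

    IndicatorOf𝒜 : (Fin k → Ω → Bool) → Set (c ⊔ ℓ₂)
    IndicatorOf𝒜 χ = ∀ i ω → (χ i ω ≡ true → 𝒜 (suc (toℕ i)) ω) × (𝒜 (suc (toℕ i)) ω → χ i ω ≡ true)

    module Truncation {χ : Fin k → Ω → Bool} (χ-spec : IndicatorOf𝒜 χ) (ω : Ω) where

      χ-downwardClosed : DownwardClosed k (λ i → χ i ω)
      χ-downwardClosed i≤j χj = proj₂ (χ-spec _ ω) (𝒜-antitone ω (s≤s i≤j) (proj₁ (χ-spec _ ω) χj))

      𝒜-from-χ : ∀ {n} (n<k : n < k) → χ (fromℕ< n<k) ω ≡ true → 𝒜 (suc n) ω
      𝒜-from-χ n<k χn = subst (λ m → 𝒜 (suc m) ω) (toℕ-fromℕ< n<k) (proj₁ (χ-spec _ ω) χn)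

      χ-from-𝒜 : ∀ {n} (n<k : n < k) → 𝒜 (suc n) ω → χ (fromℕ< n<k) ω ≡ true
      χ-from-𝒜 n<k 𝒜n = proj₂ (χ-spec _ ω) (subst (λ m → 𝒜 (suc m) ω) (≡.sym (toℕ-fromℕ< n<k)) 𝒜n)

      𝒜-from-χ-prefix : ∀ m → m ≤ k → (∀ i → toℕ i < m → χ i ω ≡ true) → 𝒜 m ω
      𝒜-from-χ-prefix zero    _   _      = 𝒜-zero ω
      𝒜-from-χ-prefix (suc n) n<k prefix =
        𝒜-from-χ n<k (prefix (fromℕ< n<k) (s≤s (≤-reflexive (toℕ-fromℕ< n<k))))

      -- the stopping time of the truncation: bags 1, …, τ are kept
      τ : ℕ
      τ = leadingTrues k (λ i → χ i ω)

      τ≤k : τ ≤ k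
      τ≤k = leadingTrues-≤ k (λ i → χ i ω)

      Ztilde≈S-τ : Ztilde χ ω ≈M S τ ω
      Ztilde≈S-τ = ∑M-masked≈prefixSum k (λ i → bag i ω) (λ i → χ i ω) τ
        (leadingTrues-true k (λ i → χ i ω)) (leadingTrues-complete k (λ i → χ i ω) χ-downwardClosed)

      𝒜-τ : 𝒜 τ ω
      𝒜-τ = 𝒜-from-χ-prefix τ τ≤k (leadingTrues-true k (λ i → χ i ω))

      𝒜-suc-τ⇒τ≡k : 𝒜 (suc τ) ω → τ ≡ k
      𝒜-suc-τ⇒τ≡k 𝒜τ+1 with m≤n⇒m<n∨m≡n τ≤k
      ... | inj₂ τ≡k = τ≡k
      ... | inj₁ τ<k = ⊥-elim (<-irrefl (toℕ-fromℕ< τ<k)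
            (leadingTrues-complete k (λ i → χ i ω) χ-downwardClosed _ (χ-from-𝒜 τ<k 𝒜τ+1)))

lemma6p8 : ∀ {c ℓ₁ ℓ₂ : Level} (R : OrderedCommutativeRing c ℓ₁ ℓ₂)
    → let open OrderedCommutativeRing R
          open Matrices R
      in ∀ (d k : ℕ) (Ω : Set)
         (l : Fin k → Ω → ℕ)
         (Z : (i : Fin k) → (ω : Ω) → Fin (l i ω) → Mat d)
         → (∀ i ω e → Symmetric (Z i ω e))
         → (ε : Carrier) → 0# <ₛ ε
         → let open BagsOfDice l Z ε
           in (χ : Fin k → Ω → Bool)
              → (∀ i ω → ((χ i ω ≡ true → 𝒜 (suc (toℕ i)) ω) × (𝒜 (suc (toℕ i)) ω → χ i ω ≡ true)))
              → ∀ (ω : Ω) → (𝒜 (suc k) ω → Ztilde χ ω ⪯ scalarI ε)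
                           × (Ztilde χ ω ⪯ scalarI ε → 𝒜 (suc k) ω)
lemma6p8 R d k Ω l Z _ ε 0<ε χ χ-spec ω = 𝒜⇒Ztilde⪯ , Ztilde⪯⇒𝒜
  where
  open Matrices R
  open BagsOfDice l Z ε
  open BagsOfDiceProperties R l Z ε
  open Truncation χ-spec ω

  𝒜⇒Ztilde⪯ : 𝒜 (suc k) ω → Ztilde χ ω ⪯ scalarI ε
  𝒜⇒Ztilde⪯ 𝒜k+1 = ⪯-respˡ-≈M R (≈M-sym R Ztilde≈S-τ)
    (𝒜-suc⇒S⪯scalarI (proj₁ 0<ε) τ ω (𝒜-antitone ω (s≤s τ≤k) 𝒜k+1))

  Ztilde⪯⇒𝒜 : Ztilde χ ω ⪯ scalarI ε → 𝒜 (suc k) ω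
  Ztilde⪯⇒𝒜 Ztilde⪯εI = subst (λ m → 𝒜 (suc m) ω) (𝒜-suc-τ⇒τ≡k 𝒜τ+1) 𝒜τ+1
    where
    𝒜τ+1 : 𝒜 (suc τ) ω
    𝒜τ+1 = 𝒜-suc ω 𝒜-τ (⪯-respˡ-≈M R Ztilde≈S-τ Ztilde⪯εI)
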